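{- Let $M\subset G$ be an inclusion of linear algebraic groups defined over $\mathbb{Q}$, with $G\subset SL_B\subset M_B$ a fixed $\mathbb{Q}$-embedding. Then there exists an integer $e\geq 1$ (depending only on these embeddings) such that for all integers $m\geq 1$ and $a\geq 1$, every commutator $txt^{ -1}x^{ -1}$ with $t\in M(a^e\mathbb{Z})$ and $x\in G\cap\big(1_B+\tfrac{m}{a}M_B(\mathbb{Z})\big)$ lies in $G(m\mathbb{Z})$.
   Context: $M_B$ is the space of $B\times B$ matrices; for a nonzero rational $r$, $rM_B(\mathbb{Z})$ is the set of matrices $rX$ with $X\in M_B(\mathbb{Z})$, and $1_B$ is the identity matrix. For an integer $k\geq1$, $G(k\mathbb{Z})=G\cap SL_B(k\mathbb{Z})$ and $M(k\mathbb{Z})=M\cap SL_B(k\mathbb{Z})$, where $SL_B(k\mathbb{Z})$ is the kernel of $SL_B(\mathbb{Z})\to SL_B(\mathbb{Z}/k\mathbb{Z})$. -}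

module Defs where

open import Data.Nat as ℕ using (ℕ; zero; suc; NonZero)
open import Data.Fin using (Fin; zero; suc; punchIn)
open import Data.Integer as ℤ using (ℤ; +_)
open import Data.Rational using (ℚ; 0ℚ; 1ℚ; _+_; _*_; -_; _/_)
open import Data.List using (List)
open import Data.List.Relation.Unary.All using (All)
open import Data.Product using (Σ; _×_; _,_)
open import Relation.Binary.PropositionalEquality using (_≡_)

Mat : ℕ → Set
Mat n = Fin n → Fin n → ℚ

MatZ : ℕ → Set
MatZ n = Fin n → Fin n → ℤ

ι : ℤ → ℚ
ι z = z / 1

sumFin : ∀ {n} → (Fin n → ℚ) → ℚ
sumFin {zero}  f = 0ℚ
sumFin {suc n} f = f zero + sumFin (λ i → f (suc i))

infixl 7 _·_
_·_ : ∀ {n} → Mat n → Mat n → Mat n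
(A · C) i j = sumFin (λ k → A i k * C k j)

δ : ∀ {n} → Fin n → Fin n → ℚ
δ zero    zero    = 1ℚ
δ (suc i) (suc j) = δ i j
δ zero    (suc _) = 0ℚ
δ (suc _) zero    = 0ℚ

1M : ∀ {n} → Mat n
1M = δ

infix 4 _≐_
_≐_ : ∀ {n} → Mat n → Mat n → Set
A ≐ C = ∀ i j → A i j ≡ C i j

altSign : ℕ → ℚ
altSign zero    = 1ℚ
altSign (suc k) = - altSign k

det : ∀ {n} → Mat n → ℚ
det {zero}  A = 1ℚ
det {suc n} A = sumFin (λ j → altSign (Data.Fin.toℕ j) * A zero j
                          * det (λ i k → A (suc i) (punchIn j k)))

data Poly (V : Set) : Set where
  con : ℚ → Poly V
  var : V → Poly V
  _⊕_ : Poly V → Poly V → Poly V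
  _⊗_ : Poly V → Poly V → Poly V

eval : ∀ {V : Set} → (V → ℚ) → Poly V → ℚ
eval ρ (con c) = c
eval ρ (var v) = ρ v
eval ρ (p ⊕ q) = eval ρ p + eval ρ q
eval ρ (p ⊗ q) = eval ρ p * eval ρ q

MPoly : ℕ → Set
MPoly n = Poly (Fin n × Fin n)

ZeroSet : ∀ {n} → List (MPoly n) → Mat n → Set
ZeroSet P A = All (λ p → eval (λ ij → A (Data.Product.proj₁ ij) (Data.Product.proj₂ ij)) p ≡ 0ℚ) P

-- P defines a linear algebraic group over ℚ: its ℚ-points form a group
-- under matrix multiplication
record IsQGroup {n : ℕ} (P : List (MPoly n)) : Set where
  field
    has-one : ZeroSet P 1M
    mul-closed : ∀ A C → ZeroSet P A → ZeroSet P C → ZeroSet P (A · C)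
    inv-closed : ∀ A → ZeroSet P A → Σ (Mat n) (λ A' → ZeroSet P A' × (A · A' ≐ 1M) × (A' · A ≐ 1M))

InSLCong : ∀ {n} → ℕ → Mat n → Set
InSLCong {n} k A = (det A ≡ 1ℚ) × Σ (MatZ n) (λ Y → ∀ i j → A i j ≡ δ i j + ι (+ k) * ι (Y i j))

InNear : ∀ {n} → (m a : ℕ) → .{{NonZero a}} → Mat n → Set
InNear {n} m a A = Σ (MatZ n) (λ X → ∀ i j → A i j ≡ δ i j + ((+ m) / a) * ι (X i j))

{-# OPTIONS --safe #-}
module Submission where

-- Write t = 1 + a^B Y and x = 1 + (m/a) X with Y, X integral. Then
-- t x = x t + (m a^(B-1)) [Y , X], so the commutator is 1 + m · [Y , X] t⁻¹ (a^(B-1) x⁻¹).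
-- Since det t = det x = 1, the inverses are adjugates: t⁻¹ is integral, and every
-- entry of x⁻¹ is a (B-1)×(B-1) minor of x, whose entries have denominator a, so
-- a^(B-1) x⁻¹ is integral. Hence e = B works (e = 1 when B = 0).

open import Defs
open import Data.Nat as ℕ using (ℕ; zero; suc; _≤_; _^_; NonZero; s≤s; z≤n)
import Data.Nat.Properties as ℕP
import Data.Nat.Coprimality as Coprime
open import Data.Integer as ℤ using (ℤ; +_)
import Data.Integer.Properties as ℤP
open import Data.Rational using (ℚ; 0ℚ; 1ℚ; _+_; _*_; -_; _/_; mkℚ; toℚᵘ)
import Data.Rational.Properties as ℚP
import Data.Rational.Unnormalised as ℚᵘ
import Data.Rational.Unnormalised.Properties as ℚᵘP
open import Data.Rational.Solver using (module +-*-Solver)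
open import Data.Fin using (Fin; zero; suc; punchIn; punchOut; toℕ; _≟_)
open import Data.Fin.Properties
  using (punchIn-injective; punchInᵢ≢i; punchOut-cong; punchOut-punchIn; punchIn-punchOut)
open import Data.Product using (Σ; _×_; _,_; proj₁; proj₂; ∃-syntax)
open import Data.List using (List)
open import Data.List.Relation.Unary.All using ([]; _∷_)
open import Data.Empty using (⊥-elim)
open import Relation.Nullary using (Dec; yes; no)
open import Relation.Binary.Bundles using (Setoid)
import Relation.Binary.Reasoning.Setoid as SetoidReasoning
open import Relation.Binary.PropositionalEquality

open +-*-Solver

ι-mkℚ : ∀ z → ι z ≡ mkℚ z 0 (Coprime.sym (Coprime.1-coprimeTo _))
ι-mkℚ z = ℚP.↥p/↧p≡p (mkℚ z 0 (Coprime.sym (Coprime.1-coprimeTo _)))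

ι-homo-+ : ∀ z w → ι (z ℤ.+ w) ≡ ι z + ι w
ι-homo-+ z w rewrite ι-mkℚ z | ι-mkℚ w =
  ℚP./-cong {p₁ = z ℤ.+ w} (cong₂ ℤ._+_ (sym (ℤP.*-identityʳ z)) (sym (ℤP.*-identityʳ w))) refl

ι-homo-* : ∀ z w → ι (z ℤ.* w) ≡ ι z * ι w
ι-homo-* z w rewrite ι-mkℚ z | ι-mkℚ w = refl

ι-homo-‿- : ∀ z → ι (ℤ.- z) ≡ - ι z
ι-homo-‿- z = begin
  ι (ℤ.- z)                ≡⟨ solve 2 (λ p q → p := p :+ q :+ :- q) refl (ι (ℤ.- z)) (ι z) ⟩
  ι (ℤ.- z) + ι z + - ι z  ≡⟨ cong (_+ - ι z) (sym (ι-homo-+ (ℤ.- z) z)) ⟩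
  ι (ℤ.- z ℤ.+ z) + - ι z  ≡⟨ cong (λ u → ι u + - ι z) (ℤP.+-inverseˡ z) ⟩
  0ℚ + - ι z               ≡⟨ ℚP.+-identityˡ (- ι z) ⟩
  - ι z                    ∎
  where open ≡-Reasoning

ι-pow-suc : ∀ a n → ι (+ (a ^ suc n)) ≡ ι (+ a) * ι (+ (a ^ n))
ι-pow-suc a n = trans (cong ι (ℤP.pos-* a (a ^ n))) (ι-homo-* (+ a) (+ (a ^ n)))

ι-*-/-cancel : ∀ m a .{{_ : NonZero a}} → ι (+ a) * (+ m / a) ≡ ι (+ m)
ι-*-/-cancel m (suc a) = ℚP.toℚᵘ-injective (begin-equality
    toℚᵘ (ι (+ suc a) * (+ m / suc a))
      ≃⟨ ℚP.toℚᵘ-homo-* (ι (+ suc a)) (+ m / suc a) ⟩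
    toℚᵘ (ι (+ suc a)) ℚᵘ.* toℚᵘ (+ m / suc a)
      ≃⟨ ℚᵘP.*-congˡ {toℚᵘ (ι (+ suc a))} (ℚP.toℚᵘ-fromℚᵘ (ℚᵘ.mkℚᵘ (+ m) a)) ⟩
    toℚᵘ (ι (+ suc a)) ℚᵘ.* ℚᵘ.mkℚᵘ (+ m) a
      ≡⟨ cong (λ u → toℚᵘ u ℚᵘ.* ℚᵘ.mkℚᵘ (+ m) a) (ι-mkℚ (+ suc a)) ⟩
    ℚᵘ.mkℚᵘ (+ suc a) 0 ℚᵘ.* ℚᵘ.mkℚᵘ (+ m) a
      ≃⟨ ℚᵘ.*≡* cross ⟩
    toℚᵘ (mkℚ (+ m) 0 (Coprime.sym (Coprime.1-coprimeTo _)))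
      ≡⟨ cong toℚᵘ (sym (ι-mkℚ (+ m))) ⟩
    toℚᵘ (ι (+ m)) ∎)
  where
  open ℚᵘP.≤-Reasoning
  cross : + suc a ℤ.* + m ℤ.* + 1 ≡ + m ℤ.* + suc (a ℕ.+ 0)
  cross = trans (ℤP.*-identityʳ _) (trans (ℤP.*-comm (+ suc a) (+ m))
                (cong (λ n → + m ℤ.* + suc n) (sym (ℕP.+-identityʳ a))))

sumFin-cong : ∀ {n} {f g : Fin n → ℚ} → (∀ i → f i ≡ g i) → sumFin f ≡ sumFin g
sumFin-cong {zero}  e = refl
sumFin-cong {suc n} e = cong₂ _+_ (e zero) (sumFin-cong (λ i → e (suc i)))

sumFin-zero : ∀ {n} → sumFin {n} (λ _ → 0ℚ) ≡ 0ℚ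
sumFin-zero {zero}  = refl
sumFin-zero {suc n} = trans (ℚP.+-identityˡ _) (sumFin-zero {n})

sumFin-distrib-+ : ∀ {n} (f g : Fin n → ℚ) → sumFin (λ i → f i + g i) ≡ sumFin f + sumFin g
sumFin-distrib-+ {zero}  f g = refl
sumFin-distrib-+ {suc n} f g =
  trans (cong (_+_ (f zero + g zero)) (sumFin-distrib-+ (λ i → f (suc i)) (λ i → g (suc i))))
        (solve 4 (λ a b c d → a :+ b :+ (c :+ d) := a :+ c :+ (b :+ d)) refl (f zero) (g zero) _ _)

*-distribˡ-sumFin : ∀ {n} c (f : Fin n → ℚ) → c * sumFin f ≡ sumFin (λ i → c * f i)
*-distribˡ-sumFin {zero}  c f = ℚP.*-zeroʳ c
*-distribˡ-sumFin {suc n} c f =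
  trans (ℚP.*-distribˡ-+ c (f zero) _) (cong (_+_ (c * f zero)) (*-distribˡ-sumFin c (λ i → f (suc i))))

*-distribʳ-sumFin : ∀ {n} c (f : Fin n → ℚ) → sumFin f * c ≡ sumFin (λ i → f i * c)
*-distribʳ-sumFin c f =
  trans (ℚP.*-comm _ c) (trans (*-distribˡ-sumFin c f) (sumFin-cong (λ i → ℚP.*-comm c (f i))))

sumFin-comm : ∀ {n m} (F : Fin n → Fin m → ℚ) →
  sumFin (λ i → sumFin (λ j → F i j)) ≡ sumFin (λ j → sumFin (λ i → F i j))
sumFin-comm {zero}  {m} F = sym (sumFin-zero {m})
sumFin-comm {suc n}     F =
  trans (cong (_+_ (sumFin (F zero))) (sumFin-comm (λ i → F (suc i))))
        (sym (sumFin-distrib-+ (F zero) (λ j → sumFin (λ i → F (suc i) j))))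

sumFin-punchIn : ∀ {n} (j : Fin (suc n)) (f : Fin (suc n) → ℚ) →
  sumFin f ≡ f j + sumFin (λ l → f (punchIn j l))
sumFin-punchIn         zero    f = refl
sumFin-punchIn {suc n} (suc j) f =
  trans (cong (_+_ (f zero)) (sumFin-punchIn j (λ i → f (suc i))))
        (solve 3 (λ a b c → a :+ (b :+ c) := b :+ (a :+ c)) refl (f zero) (f (suc j)) _)

δ-refl : ∀ {n} (i : Fin n) → δ i i ≡ 1ℚ
δ-refl zero    = refl
δ-refl (suc i) = δ-refl i

δ-≢ : ∀ {n} (i j : Fin n) → i ≢ j → δ i j ≡ 0ℚ
δ-≢ zero    zero    i≢j = ⊥-elim (i≢j refl)
δ-≢ zero    (suc j) i≢j = refl
δ-≢ (suc i) zero    i≢j = refl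
δ-≢ (suc i) (suc j) i≢j = δ-≢ i j (λ e → i≢j (cong suc e))

δ-sym : ∀ {n} (i j : Fin n) → δ i j ≡ δ j i
δ-sym zero    zero    = refl
δ-sym zero    (suc j) = refl
δ-sym (suc i) zero    = refl
δ-sym (suc i) (suc j) = δ-sym i j

sumFin-δˡ : ∀ {n} (i : Fin n) (f : Fin n → ℚ) → sumFin (λ k → δ i k * f k) ≡ f i
sumFin-δˡ {suc n} zero f =
  trans (cong (_+_ (1ℚ * f zero)) (trans (sumFin-cong (λ k → ℚP.*-zeroˡ (f (suc k)))) (sumFin-zero {n})))
        (solve 1 (λ a → con 1ℚ :* a :+ con 0ℚ := a) refl (f zero))
sumFin-δˡ {suc n} (suc i) f =
  trans (cong (_+ sumFin (λ k → δ i k * f (suc k))) (ℚP.*-zeroˡ (f zero)))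
        (trans (ℚP.+-identityˡ _) (sumFin-δˡ i (λ k → f (suc k))))

sumFin-δʳ : ∀ {n} (j : Fin n) (f : Fin n → ℚ) → sumFin (λ k → f k * δ k j) ≡ f j
sumFin-δʳ j f =
  trans (sumFin-cong (λ k → trans (ℚP.*-comm (f k) _) (cong (_* f k) (δ-sym k j)))) (sumFin-δˡ j f)

-- Matrix algebra

infixl 6 _⊞_ _⊟_
infixr 7 _⊙_

_⊞_ : ∀ {n} → Mat n → Mat n → Mat n
(A ⊞ C) i j = A i j + C i j

_⊟_ : ∀ {n} → Mat n → Mat n → Mat n
(A ⊟ C) i j = A i j + - C i j

_⊙_ : ∀ {n} → ℚ → Mat n → Mat n
(c ⊙ A) i j = c * A i j

≐-setoid : ℕ → Setoid _ _
≐-setoid n = record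
  { Carrier = Mat n
  ; _≈_ = _≐_
  ; isEquivalence = record
    { refl = λ i j → refl ; sym = λ e i j → sym (e i j) ; trans = λ e f i j → trans (e i j) (f i j) } }

module _ {n : ℕ} where
  open Setoid (≐-setoid n) public
    using () renaming (sym to ≐-sym; trans to ≐-trans)

·-cong : ∀ {n} {A A' C C' : Mat n} → A ≐ A' → C ≐ C' → A · C ≐ A' · C'
·-cong e f i j = sumFin-cong (λ k → cong₂ _*_ (e i k) (f k j))

·-congˡ : ∀ {n} {A A' : Mat n} (C : Mat n) → A ≐ A' → A · C ≐ A' · C
·-congˡ C e i j = sumFin-cong (λ k → cong (_* C k j) (e i k))

·-congʳ : ∀ {n} (A : Mat n) {C C' : Mat n} → C ≐ C' → A · C ≐ A · C'
·-congʳ A f i j = sumFin-cong (λ k → cong (A i k *_) (f k j))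

⊞-cong : ∀ {n} {A A' C C' : Mat n} → A ≐ A' → C ≐ C' → A ⊞ C ≐ A' ⊞ C'
⊞-cong e f i j = cong₂ _+_ (e i j) (f i j)

⊞-congˡ : ∀ {n} {A A' : Mat n} (C : Mat n) → A ≐ A' → A ⊞ C ≐ A' ⊞ C
⊞-congˡ C e i j = cong (_+ C i j) (e i j)

⊞-congʳ : ∀ {n} (A : Mat n) {C C' : Mat n} → C ≐ C' → A ⊞ C ≐ A ⊞ C'
⊞-congʳ A f i j = cong (_+_ (A i j)) (f i j)

·-assoc : ∀ {n} (A C D : Mat n) → (A · C) · D ≐ A · (C · D)
·-assoc A C D i j = begin
  sumFin (λ k → sumFin (λ l → A i l * C l k) * D k j)
    ≡⟨ sumFin-cong (λ k → *-distribʳ-sumFin (D k j) (λ l → A i l * C l k)) ⟩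
  sumFin (λ k → sumFin (λ l → A i l * C l k * D k j))
    ≡⟨ sumFin-comm (λ k l → A i l * C l k * D k j) ⟩
  sumFin (λ l → sumFin (λ k → A i l * C l k * D k j))
    ≡⟨ sumFin-cong (λ l → trans (sumFin-cong (λ k → ℚP.*-assoc (A i l) (C l k) (D k j)))
                                 (sym (*-distribˡ-sumFin (A i l) (λ k → C l k * D k j)))) ⟩
  sumFin (λ l → A i l * sumFin (λ k → C l k * D k j)) ∎
  where open ≡-Reasoning

·-distribˡ-⊞ : ∀ {n} (A C D : Mat n) → A · (C ⊞ D) ≐ A · C ⊞ A · D
·-distribˡ-⊞ A C D i j =
  trans (sumFin-cong (λ k → ℚP.*-distribˡ-+ (A i k) (C k j) (D k j)))
        (sumFin-distrib-+ (λ k → A i k * C k j) (λ k → A i k * D k j))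

·-distribʳ-⊞ : ∀ {n} (A C D : Mat n) → (C ⊞ D) · A ≐ C · A ⊞ D · A
·-distribʳ-⊞ A C D i j =
  trans (sumFin-cong (λ k → ℚP.*-distribʳ-+ (A k j) (C i k) (D i k)))
        (sumFin-distrib-+ (λ k → C i k * A k j) (λ k → D i k * A k j))

⊙-·ˡ : ∀ {n} c (A C : Mat n) → (c ⊙ A) · C ≐ c ⊙ (A · C)
⊙-·ˡ c A C i j =
  trans (sumFin-cong (λ k → ℚP.*-assoc c (A i k) (C k j))) (sym (*-distribˡ-sumFin c (λ k → A i k * C k j)))

⊙-·ʳ : ∀ {n} c (A C : Mat n) → A · (c ⊙ C) ≐ c ⊙ (A · C)
⊙-·ʳ c A C i j =
  trans (sumFin-cong (λ k → solve 3 (λ x a y → x :* (a :* y) := a :* (x :* y)) refl (A i k) c (C k j)))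
        (sym (*-distribˡ-sumFin c (λ k → A i k * C k j)))

·-identityˡ : ∀ {n} (A : Mat n) → 1M · A ≐ A
·-identityˡ A i j = sumFin-δˡ i (λ k → A k j)

·-identityʳ : ∀ {n} (A : Mat n) → A · 1M ≐ A
·-identityʳ A i j = sumFin-δʳ j (λ k → A i k)

module _ {n : ℕ} where
  open SetoidReasoning (≐-setoid n)

  inverse-unique : (A A' T : Mat n) → T · A ≐ 1M → A · A' ≐ 1M → A' ≐ T
  inverse-unique A A' T left right = begin
    A'           ≈⟨ ≐-sym (·-identityˡ A') ⟩
    1M · A'      ≈⟨ ·-congˡ A' (≐-sym left) ⟩
    (T · A) · A' ≈⟨ ·-assoc T A A' ⟩
    T · (A · A') ≈⟨ ·-congʳ T right ⟩
    T · 1M       ≈⟨ ·-identityʳ T ⟩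
    T            ∎

  ·-near-identity : (c d : ℚ) (P Q : Mat n) →
    (1M ⊞ c ⊙ P) · (1M ⊞ d ⊙ Q) ≐ (λ i j → δ i j + c * P i j + d * Q i j + c * (d * (P · Q) i j))
  ·-near-identity c d P Q = begin
    (1M ⊞ c ⊙ P) · (1M ⊞ d ⊙ Q)
      ≈⟨ ·-distribʳ-⊞ _ 1M (c ⊙ P) ⟩
    1M · (1M ⊞ d ⊙ Q) ⊞ (c ⊙ P) · (1M ⊞ d ⊙ Q)
      ≈⟨ ⊞-cong (·-identityˡ _) (·-distribˡ-⊞ (c ⊙ P) 1M (d ⊙ Q)) ⟩
    (1M ⊞ d ⊙ Q) ⊞ ((c ⊙ P) · 1M ⊞ (c ⊙ P) · (d ⊙ Q))
      ≈⟨ ⊞-congʳ (1M ⊞ d ⊙ Q) (⊞-cong (·-identityʳ (c ⊙ P))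
                                (≐-trans (⊙-·ˡ c P (d ⊙ Q)) (λ i j → cong (c *_) (⊙-·ʳ d P Q i j)))) ⟩
    (1M ⊞ d ⊙ Q) ⊞ (c ⊙ P ⊞ c ⊙ (d ⊙ (P · Q)))
      ≈⟨ (λ i j → solve 6 (λ e q p c d r → e :+ d :* q :+ (c :* p :+ c :* (d :* r))
                                          := e :+ c :* p :+ d :* q :+ c :* (d :* r))
                    refl (δ i j) (Q i j) (P i j) c d ((P · Q) i j)) ⟩
    _ ∎

  ·-swap-near-identity : (k μ : ℚ) (Y X : Mat n) →
    (1M ⊞ k ⊙ Y) · (1M ⊞ μ ⊙ X) ≐ (1M ⊞ μ ⊙ X) · (1M ⊞ k ⊙ Y) ⊞ (k * μ) ⊙ (Y · X ⊟ X · Y)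
  ·-swap-near-identity k μ Y X =
    ≐-trans (·-near-identity k μ Y X)
      (≐-trans rearrange (≐-sym (⊞-congˡ ((k * μ) ⊙ (Y · X ⊟ X · Y)) (·-near-identity μ k X Y))))
    where
    rearrange : (λ i j → δ i j + k * Y i j + μ * X i j + k * (μ * (Y · X) i j)) ≐
                (λ i j → δ i j + μ * X i j + k * Y i j + μ * (k * (X · Y) i j)) ⊞ (k * μ) ⊙ (Y · X ⊟ X · Y)
    rearrange i j =
      solve 7 (λ d y x yx xy k μ → d :+ k :* y :+ μ :* x :+ k :* (μ :* yx)
                                := d :+ μ :* x :+ k :* y :+ μ :* (k :* xy) :+ (k :* μ) :* (yx :+ :- xy))
        refl (δ i j) (Y i j) (X i j) ((Y · X) i j) ((X · Y) i j) k μ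

  commutator-near-identity : (k μ : ℚ) (Y X : Mat n) {t t' x x' : Mat n} →
    t ≐ 1M ⊞ k ⊙ Y → x ≐ 1M ⊞ μ ⊙ X → t · t' ≐ 1M → x · x' ≐ 1M →
    t · x · t' · x' ≐ 1M ⊞ (k * μ) ⊙ ((Y · X ⊟ X · Y) · t' · x')
  commutator-near-identity k μ Y X {t} {t'} {x} {x'} ht hx tt' xx' = begin
    t · x · t' · x'
      ≈⟨ ·-congˡ x' (·-congˡ t' tx≐xt+κD) ⟩
    (x · t ⊞ κ ⊙ D) · t' · x'
      ≈⟨ ·-congˡ x' (·-distribʳ-⊞ t' (x · t) (κ ⊙ D)) ⟩
    ((x · t) · t' ⊞ (κ ⊙ D) · t') · x'
      ≈⟨ ·-congˡ x' (⊞-cong xtt'≐x (⊙-·ˡ κ D t')) ⟩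
    (x ⊞ κ ⊙ (D · t')) · x'
      ≈⟨ ·-distribʳ-⊞ x' x (κ ⊙ (D · t')) ⟩
    x · x' ⊞ (κ ⊙ (D · t')) · x'
      ≈⟨ ⊞-cong xx' (⊙-·ˡ κ (D · t') x') ⟩
    1M ⊞ κ ⊙ (D · t' · x') ∎
    where
    κ : ℚ
    κ = k * μ
    D : Mat n
    D = Y · X ⊟ X · Y
    tx≐xt+κD : t · x ≐ x · t ⊞ κ ⊙ D
    tx≐xt+κD = ≐-trans (·-cong ht hx)
      (≐-trans (·-swap-near-identity k μ Y X) (⊞-congˡ (κ ⊙ D) (·-cong (≐-sym hx) (≐-sym ht))))
    xtt'≐x : (x · t) · t' ≐ x
    xtt'≐x = ≐-trans (·-assoc x t t') (≐-trans (·-congʳ x tt') (·-identityʳ x))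

-- Laplace expansion and the adjugate

minor : ∀ {n} → Mat (suc n) → Fin (suc n) → Fin (suc n) → Mat n
minor A r c i j = A (punchIn r i) (punchIn c j)

sg : ∀ {n} → Fin n → ℚ
sg j = altSign (toℕ j)

det-cong : ∀ {n} {A A' : Mat n} → A ≐ A' → det A ≡ det A'
det-cong {zero}  e = refl
det-cong {suc n} e = sumFin-cong (λ j → cong₂ (λ u v → sg j * u * v) (e zero j)
  (det-cong (λ i k → e (suc i) (punchIn j k))))

-- Deleting column j and then column l of what remains deletes the same two columns
-- as deleting column punchIn j l first and then column partner j l.
partner : ∀ {m} → Fin (suc m) → Fin m → Fin m
partner zero    zero    = zero
partner zero    (suc l) = zero
partner (suc j) zero    = j
partner (suc j) (suc l) = suc (partner j l)

punchIn-partner : ∀ {m} (j : Fin (suc m)) (l : Fin m) → punchIn (punchIn j l) (partner j l) ≡ j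
punchIn-partner zero    zero    = refl
punchIn-partner zero    (suc l) = refl
punchIn-partner (suc j) zero    = refl
punchIn-partner (suc j) (suc l) = cong suc (punchIn-partner j l)

punchIn-punchIn-partner : ∀ {m} (j : Fin (suc (suc m))) (l : Fin (suc m)) (y : Fin m) →
  punchIn j (punchIn l y) ≡ punchIn (punchIn j l) (punchIn (partner j l) y)
punchIn-punchIn-partner zero    zero    y       = refl
punchIn-punchIn-partner zero    (suc l) y       = refl
punchIn-punchIn-partner (suc j) zero    y       = refl
punchIn-punchIn-partner (suc j) (suc l) zero    = refl
punchIn-punchIn-partner (suc j) (suc l) (suc y) = cong suc (punchIn-punchIn-partner j l y)

sg-partner : ∀ {m} (j : Fin (suc m)) (l : Fin m) → sg (punchIn j l) * sg (partner j l) ≡ - (sg j * sg l)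
sg-partner zero    zero    = refl
sg-partner zero    (suc l) = solve 1 (λ a → (:- (:- a)) :* con 1ℚ := :- (con 1ℚ :* (:- a))) refl (sg l)
sg-partner (suc j) zero    = solve 1 (λ a → con 1ℚ :* a := :- ((:- a) :* con 1ℚ)) refl (sg j)
sg-partner (suc j) (suc l) = begin
  (- sg (punchIn j l)) * (- sg (partner j l))
    ≡⟨ solve 2 (λ a b → (:- a) :* (:- b) := a :* b) refl (sg (punchIn j l)) (sg (partner j l)) ⟩
  sg (punchIn j l) * sg (partner j l)
    ≡⟨ sg-partner j l ⟩
  - (sg j * sg l)
    ≡⟨ solve 2 (λ a b → :- (a :* b) := :- ((:- a) :* (:- b))) refl (sg j) (sg l) ⟩
  - ((- sg j) * (- sg l)) ∎
  where open ≡-Reasoning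

-- Expanding det A along row 0 and then each minor along row r + 1, or in the other
-- order, gives two double sums over the pairs of distinct columns (j , k) used by
-- rows 0 and r + 1; F is the summand indexed by such a pair.
module ExpandTwoRows {n : ℕ} (A : Mat (suc (suc n))) (r : Fin (suc n)) where
  minorDet : (Fin n → Fin (suc (suc n))) → ℚ
  minorDet σ = det (λ x y → A (suc (punchIn r x)) (σ y))

  row0First : Fin (suc (suc n)) → Fin (suc n) → ℚ
  row0First j l = sg j * A zero j
    * (sg r * sg l * A (suc r) (punchIn j l) * minorDet (λ y → punchIn j (punchIn l y)))

  rowRFirst : Fin (suc (suc n)) → Fin (suc n) → ℚ
  rowRFirst k l = sg (suc r) * sg k * A (suc r) k
    * (sg l * A zero (punchIn k l) * minorDet (λ y → punchIn k (punchIn l y)))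

  F : Fin (suc (suc n)) → Fin (suc (suc n)) → ℚ
  F j k with j ≟ k
  ... | yes _  = 0ℚ
  ... | no j≢k = row0First j (punchOut j≢k)

  F-diagonal : ∀ j → F j j ≡ 0ℚ
  F-diagonal j with j ≟ j
  ... | yes _  = refl
  ... | no j≢j = ⊥-elim (j≢j refl)

  F-row0First : ∀ j l → F j (punchIn j l) ≡ row0First j l
  F-row0First j l with j ≟ punchIn j l
  ... | yes e  = ⊥-elim (punchInᵢ≢i j l (sym e))
  ... | no _   = cong (row0First j) (trans (punchOut-cong j refl) (punchOut-punchIn j))

  row0First-partner : ∀ k l → row0First (punchIn k l) (partner k l) ≡ rowRFirst k l
  row0First-partner k l = begin
    sg j * A zero j * (sg r * sg q * A (suc r) (punchIn j q) * minorDet (λ y → punchIn j (punchIn q y)))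
      ≡⟨ cong₂ (λ u v → sg j * A zero j * (sg r * sg q * A (suc r) u * v)) (punchIn-partner k l)
           (det-cong (λ x y → cong (A (suc (punchIn r x))) (sym (punchIn-punchIn-partner k l y)))) ⟩
    sg j * A zero j * (sg r * sg q * A (suc r) k * d)
      ≡⟨ solve 6 (λ a b c u v w → a :* u :* (c :* b :* v :* w) := (a :* b) :* (c :* u :* v :* w))
           refl (sg j) (sg q) (sg r) (A zero j) (A (suc r) k) d ⟩
    (sg j * sg q) * (sg r * A zero j * A (suc r) k * d)
      ≡⟨ cong (_* (sg r * A zero j * A (suc r) k * d)) (sg-partner k l) ⟩
    - (sg k * sg l) * (sg r * A zero j * A (suc r) k * d)
      ≡⟨ solve 6 (λ a b c u v w → (:- (a :* b)) :* (c :* u :* v :* w) := (:- c) :* a :* v :* (b :* u :* w))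
           refl (sg k) (sg l) (sg r) (A zero j) (A (suc r) k) d ⟩
    rowRFirst k l ∎
    where
    open ≡-Reasoning
    j : Fin (suc (suc n))
    j = punchIn k l
    q : Fin (suc n)
    q = partner k l
    d : ℚ
    d = minorDet (λ y → punchIn k (punchIn l y))

  F-rowRFirst : ∀ k l → F (punchIn k l) k ≡ rowRFirst k l
  F-rowRFirst k l with punchIn k l ≟ k
  ... | yes e   = ⊥-elim (punchInᵢ≢i k l e)
  ... | no j≢k  = trans (cong (row0First (punchIn k l))
                          (punchIn-injective (punchIn k l) _ _
                            (trans (punchIn-punchOut j≢k) (sym (punchIn-partner k l)))))
                        (row0First-partner k l)

  sumFin-F-row : ∀ j → sumFin (F j) ≡ sumFin (row0First j)
  sumFin-F-row j = trans (sumFin-punchIn j (F j))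
    (trans (cong₂ _+_ (F-diagonal j) (sumFin-cong (F-row0First j))) (ℚP.+-identityˡ _))

  sumFin-F-column : ∀ k → sumFin (λ j → F j k) ≡ sumFin (rowRFirst k)
  sumFin-F-column k = trans (sumFin-punchIn k (λ j → F j k))
    (trans (cong₂ _+_ (F-diagonal k) (sumFin-cong (F-rowRFirst k))) (ℚP.+-identityˡ _))

det-expandRow : ∀ {n} (A : Mat (suc n)) (r : Fin (suc n)) →
  det A ≡ sumFin (λ c → sg r * sg c * A r c * det (minor A r c))
det-expandRow A zero = sumFin-cong (λ c →
  solve 3 (λ a b d → a :* b :* d := con 1ℚ :* a :* b :* d) refl (sg c) (A zero c) (det (minor A zero c)))
det-expandRow {suc n} A (suc r) = begin
  sumFin (λ j → sg j * A zero j * det (minor A zero j))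
    ≡⟨ sumFin-cong (λ j → trans (cong (sg j * A zero j *_) (det-expandRow (minor A zero j) r))
         (*-distribˡ-sumFin (sg j * A zero j)
           (λ l → sg r * sg l * A (suc r) (punchIn j l) * det (minor (minor A zero j) r l)))) ⟩
  sumFin (λ j → sumFin (row0First j))
    ≡⟨ sym (sumFin-cong sumFin-F-row) ⟩
  sumFin (λ j → sumFin (F j))
    ≡⟨ sumFin-comm F ⟩
  sumFin (λ k → sumFin (λ j → F j k))
    ≡⟨ sumFin-cong sumFin-F-column ⟩
  sumFin (λ k → sumFin (rowRFirst k))
    ≡⟨ sym (sumFin-cong (λ k → *-distribˡ-sumFin (sg (suc r) * sg k * A (suc r) k)
         (λ l → sg l * A zero (punchIn k l) * det (minor (minor A (suc r) k) zero l)))) ⟩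
  sumFin (λ c → sg (suc r) * sg c * A (suc r) c * det (minor A (suc r) c)) ∎
  where
  open ≡-Reasoning
  open ExpandTwoRows A r

det₂ : (A : Mat 2) → det A ≡ A zero zero * A (suc zero) (suc zero) + - (A zero (suc zero) * A (suc zero) zero)
det₂ A = solve 4 (λ a b c d →
    con 1ℚ :* a :* (con 1ℚ :* d :* con 1ℚ :+ con 0ℚ) :+ ((:- con 1ℚ) :* b :* (con 1ℚ :* c :* con 1ℚ :+ con 0ℚ) :+ con 0ℚ)
  := a :* d :+ :- (b :* c))
  refl (A zero zero) (A zero (suc zero)) (A (suc zero) zero) (A (suc zero) (suc zero))

avoid₂ : ∀ {m} (i j : Fin (suc (suc (suc m)))) → Σ (Fin (suc (suc (suc m)))) (λ r → r ≢ i × r ≢ j)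
avoid₂ zero          zero          = suc zero       , (λ ()) , (λ ())
avoid₂ zero          (suc zero)    = suc (suc zero) , (λ ()) , (λ ())
avoid₂ zero          (suc (suc _)) = suc zero       , (λ ()) , (λ ())
avoid₂ (suc zero)    zero          = suc (suc zero) , (λ ()) , (λ ())
avoid₂ (suc zero)    (suc zero)    = zero           , (λ ()) , (λ ())
avoid₂ (suc zero)    (suc (suc _)) = zero           , (λ ()) , (λ ())
avoid₂ (suc (suc _)) zero          = suc zero       , (λ ()) , (λ ())
avoid₂ (suc (suc _)) (suc zero)    = zero           , (λ ()) , (λ ())
avoid₂ (suc (suc _)) (suc (suc _)) = zero           , (λ ()) , (λ ())

-- For n ≥ 3, expand along a third row r: every minor still has two equal rows.
det-equalRows : ∀ {n} (A : Mat n) (i j : Fin n) → i ≢ j → (∀ c → A i c ≡ A j c) → det A ≡ 0ℚ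
det-equalRows {1} A zero zero i≢j e = ⊥-elim (i≢j refl)
det-equalRows {2} A zero zero i≢j e = ⊥-elim (i≢j refl)
det-equalRows {2} A (suc zero) (suc zero) i≢j e = ⊥-elim (i≢j refl)
det-equalRows {2} A zero (suc zero) i≢j e = trans (det₂ A)
  (trans (cong₂ (λ u v → A zero zero * u + - (A zero (suc zero) * v)) (sym (e (suc zero))) (sym (e zero)))
    (solve 2 (λ a b → a :* b :+ :- (b :* a) := con 0ℚ) refl (A zero zero) (A zero (suc zero))))
det-equalRows {2} A (suc zero) zero i≢j e = det-equalRows A zero (suc zero) (λ ()) (λ c → sym (e c))
det-equalRows {suc (suc (suc m))} A i j i≢j e = trans (det-expandRow A r)
  (trans (sumFin-cong (λ c → trans (cong (sg r * sg c * A r c *_)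
                                          (det-equalRows (minor A r c) i' j' i'≢j' (rows-equal c)))
                                   (ℚP.*-zeroʳ (sg r * sg c * A r c))))
         (sumFin-zero {suc (suc (suc m))}))
  where
  r : Fin (suc (suc (suc m)))
  r = proj₁ (avoid₂ i j)
  r≢i : r ≢ i
  r≢i = proj₁ (proj₂ (avoid₂ i j))
  r≢j : r ≢ j
  r≢j = proj₂ (proj₂ (avoid₂ i j))
  i' j' : Fin (suc (suc m))
  i' = punchOut r≢i
  j' = punchOut r≢j
  i'≢j' : i' ≢ j'
  i'≢j' q = i≢j (trans (sym (punchIn-punchOut r≢i)) (trans (cong (punchIn r) q) (punchIn-punchOut r≢j)))
  rows-equal : ∀ c y → minor A r c i' y ≡ minor A r c j' y
  rows-equal c y = trans (cong (λ u → A u (punchIn c y)) (punchIn-punchOut r≢i))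
    (trans (e (punchIn c y)) (cong (λ u → A u (punchIn c y)) (sym (punchIn-punchOut r≢j))))

adj : ∀ {n} → Mat (suc n) → Mat (suc n)
adj A k j = sg j * sg k * det (minor A j k)

replaceRow : ∀ {n} → Mat n → Fin n → (Fin n → ℚ) → Mat n
replaceRow A j v i c with i ≟ j
... | yes _ = v c
... | no _  = A i c

replaceRow-here : ∀ {n} (A : Mat n) j v c → replaceRow A j v j c ≡ v c
replaceRow-here A j v c with j ≟ j
... | yes _  = refl
... | no j≢j = ⊥-elim (j≢j refl)

replaceRow-there : ∀ {n} (A : Mat n) j v i c → i ≢ j → replaceRow A j v i c ≡ A i c
replaceRow-there A j v i c i≢j with i ≟ j
... | yes i≡j = ⊥-elim (i≢j i≡j)
... | no _    = refl

replaceRow-self : ∀ {n} (A : Mat n) j → replaceRow A j (A j) ≐ A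
replaceRow-self A j i c with i ≟ j
... | yes refl = refl
... | no _     = refl

-- (A · adj A) i j is det A with row j replaced by row i.
·-adj : ∀ {n} (A : Mat (suc n)) → A · adj A ≐ det A ⊙ 1M
·-adj {n} A i j = trans expansion (byCases (i ≟ j))
  where
  A[j≔i] : Mat (suc n)
  A[j≔i] = replaceRow A j (A i)
  expansion : (A · adj A) i j ≡ det A[j≔i]
  expansion = sym (trans (det-expandRow A[j≔i] j) (sumFin-cong (λ k →
    trans (cong₂ (λ u v → sg j * sg k * u * v) (replaceRow-here A j (A i) k)
            (det-cong (λ x y → replaceRow-there A j (A i) (punchIn j x) (punchIn k y) (punchInᵢ≢i j x))))
          (solve 4 (λ a b c d → a :* b :* c :* d := c :* (a :* b :* d)) refl (sg j) (sg k) (A i k) (det (minor A j k))))))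
  byCases : Dec (i ≡ j) → det A[j≔i] ≡ det A * δ i j
  byCases (yes refl) =
    trans (det-cong (replaceRow-self A i)) (trans (sym (ℚP.*-identityʳ (det A))) (cong (det A *_) (sym (δ-refl i))))
  byCases (no i≢j) =
    trans (det-equalRows A[j≔i] i j i≢j (λ c → trans (replaceRow-there A j (A i) i c i≢j) (sym (replaceRow-here A j (A i) c))))
          (trans (sym (ℚP.*-zeroʳ (det A))) (cong (det A *_) (sym (δ-≢ i j i≢j))))

·-adj-det1 : ∀ {n} (A : Mat (suc n)) → det A ≡ 1ℚ → A · adj A ≐ 1M
·-adj-det1 A det≡1 i j = trans (·-adj A i j) (trans (cong (_* δ i j) det≡1) (ℚP.*-identityˡ (δ i j)))

-- Integrality

Integral : ℚ → Set
Integral q = Σ ℤ (λ z → q ≡ ι z)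

Integral-ι : ∀ z → Integral (ι z)
Integral-ι z = z , refl

Integral-+ : ∀ {p q} → Integral p → Integral q → Integral (p + q)
Integral-+ (z , e) (w , f) = z ℤ.+ w , trans (cong₂ _+_ e f) (sym (ι-homo-+ z w))

Integral-* : ∀ {p q} → Integral p → Integral q → Integral (p * q)
Integral-* (z , e) (w , f) = z ℤ.* w , trans (cong₂ _*_ e f) (sym (ι-homo-* z w))

Integral-neg : ∀ {p} → Integral p → Integral (- p)
Integral-neg (z , e) = ℤ.- z , trans (cong -_ e) (sym (ι-homo-‿- z))

Integral-≡ : ∀ {p q} → p ≡ q → Integral p → Integral q
Integral-≡ refl h = h

Integral-δ : ∀ {n} (i j : Fin n) → Integral (δ i j)
Integral-δ zero    zero    = Integral-ι (+ 1)
Integral-δ zero    (suc j) = Integral-ι (+ 0)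
Integral-δ (suc i) zero    = Integral-ι (+ 0)
Integral-δ (suc i) (suc j) = Integral-δ i j

Integral-altSign : ∀ k → Integral (altSign k)
Integral-altSign zero    = Integral-ι (+ 1)
Integral-altSign (suc k) = Integral-neg (Integral-altSign k)

Integral-sumFin : ∀ {n} {f : Fin n → ℚ} → (∀ i → Integral (f i)) → Integral (sumFin f)
Integral-sumFin {zero}  h = Integral-ι (+ 0)
Integral-sumFin {suc n} h = Integral-+ (h zero) (Integral-sumFin (λ i → h (suc i)))

IntegralM : ∀ {n} → Mat n → Set
IntegralM A = ∀ i j → Integral (A i j)

IntegralM-· : ∀ {n} {A C : Mat n} → IntegralM A → IntegralM C → IntegralM (A · C)
IntegralM-· hA hC i j = Integral-sumFin (λ k → Integral-* (hA i k) (hC k j))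

IntegralM-⊟ : ∀ {n} {A C : Mat n} → IntegralM A → IntegralM C → IntegralM (A ⊟ C)
IntegralM-⊟ hA hC i j = Integral-+ (hA i j) (Integral-neg (hC i j))

IntegralM-≐ : ∀ {n} {A C : Mat n} → A ≐ C → IntegralM A → IntegralM C
IntegralM-≐ e h i j = Integral-≡ (e i j) (h i j)

toMat : ∀ {n} → MatZ n → Mat n
toMat Y i j = ι (Y i j)

IntegralM-toMat : ∀ {n} (Y : MatZ n) → IntegralM (toMat Y)
IntegralM-toMat Y i j = Integral-ι (Y i j)

IntegralM-1M⊞ι⊙ : ∀ {n} k (Y : MatZ n) → IntegralM (1M ⊞ ι k ⊙ toMat Y)
IntegralM-1M⊞ι⊙ k Y i j = Integral-+ (Integral-δ i j) (Integral-* (Integral-ι k) (Integral-ι (Y i j)))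

det-integral-scaled : ∀ {n} a (A : Mat n) → IntegralM (ι (+ a) ⊙ A) → Integral (ι (+ (a ^ n)) * det A)
det-integral-scaled {zero}  a A h = Integral-ι (+ 1)
det-integral-scaled {suc n} a A h = Integral-≡ (sym expand)
  (Integral-sumFin (λ j → Integral-* (Integral-* (Integral-altSign (toℕ j)) (h zero j))
                                     (det-integral-scaled a (minor A zero j) (λ x y → h (suc x) (punchIn j y)))))
  where
  expand : ι (+ (a ^ suc n)) * det A
         ≡ sumFin (λ j → sg j * (ι (+ a) * A zero j) * (ι (+ (a ^ n)) * det (minor A zero j)))
  expand = trans (cong (_* det A) (ι-pow-suc a n))
    (trans (*-distribˡ-sumFin (ι (+ a) * ι (+ (a ^ n))) (λ j → sg j * A zero j * det (minor A zero j)))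
      (sumFin-cong (λ j → solve 5 (λ p q s x d → p :* q :* (s :* x :* d) := s :* (p :* x) :* (q :* d))
                            refl (ι (+ a)) (ι (+ (a ^ n))) (sg j) (A zero j) (det (minor A zero j)))))

adj-integral-scaled : ∀ {n} a (A : Mat (suc n)) → IntegralM (ι (+ a) ⊙ A) → IntegralM (ι (+ (a ^ n)) ⊙ adj A)
adj-integral-scaled {n} a A h k j = Integral-≡ (sym regroup)
  (Integral-* (Integral-* (Integral-altSign (toℕ j)) (Integral-altSign (toℕ k)))
              (det-integral-scaled a (minor A j k) (λ x y → h (punchIn j x) (punchIn k y))))
  where
  regroup : ι (+ (a ^ n)) * adj A k j ≡ sg j * sg k * (ι (+ (a ^ n)) * det (minor A j k))
  regroup = solve 4 (λ p s t d → p :* (s :* t :* d) := s :* t :* (p :* d))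
    refl (ι (+ (a ^ n))) (sg j) (sg k) (det (minor A j k))

adj-integral : ∀ {n} (A : Mat (suc n)) → IntegralM A → IntegralM (adj A)
adj-integral {n} A h k j = Integral-≡ unscale
  (adj-integral-scaled 1 A (λ i j → Integral-≡ (sym (ℚP.*-identityˡ (A i j))) (h i j)) k j)
  where
  unscale : ι (+ (1 ^ n)) * adj A k j ≡ adj A k j
  unscale = trans (cong (λ u → ι (+ u) * adj A k j) (ℕP.^-zeroˡ n)) (ℚP.*-identityˡ (adj A k j))

InNear-scaled-integral : ∀ {n} m a .{{_ : NonZero a}} {x : Mat n} → InNear m a x → IntegralM (ι (+ a) ⊙ x)
InNear-scaled-integral m a {x} (X , hx) i j = Integral-≡ (sym clear)
  (Integral-+ (Integral-* (Integral-ι (+ a)) (Integral-δ i j)) (Integral-* (Integral-ι (+ m)) (Integral-ι (X i j))))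
  where
  clear : ι (+ a) * x i j ≡ ι (+ a) * δ i j + ι (+ m) * ι (X i j)
  clear = trans (cong (ι (+ a) *_) (hx i j))
    (trans (solve 4 (λ p d q z → p :* (d :+ q :* z) := p :* d :+ (p :* q) :* z) refl (ι (+ a)) (δ i j) (+ m / a) (ι (X i j)))
           (cong (λ u → ι (+ a) * δ i j + u * ι (X i j)) (ι-*-/-cancel m a)))

-- Groups cut out by polynomials

eval-cong : ∀ {V : Set} {ρ ρ' : V → ℚ} → (∀ v → ρ v ≡ ρ' v) → ∀ p → eval ρ p ≡ eval ρ' p
eval-cong e (con c) = refl
eval-cong e (var v) = e v
eval-cong e (p ⊕ q) = cong₂ _+_ (eval-cong e p) (eval-cong e q)
eval-cong e (p ⊗ q) = cong₂ _*_ (eval-cong e p) (eval-cong e q)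

ZeroSet-≐ : ∀ {n} {P : List (MPoly n)} {A A' : Mat n} → ZeroSet P A → A ≐ A' → ZeroSet P A'
ZeroSet-≐ []                   e = []
ZeroSet-≐ (_∷_ {x = p} z zs) e = trans (sym (eval-cong (λ ij → e (proj₁ ij) (proj₂ ij)) p)) z ∷ ZeroSet-≐ zs e

module _ {n : ℕ} {P : List (MPoly n)} (group : IsQGroup P) where
  open IsQGroup group

  leftInverse : ∀ A → ZeroSet P A → Σ (Mat n) (λ T → ZeroSet P T × T · A ≐ 1M)
  leftInverse A A∈ = let (T , T∈ , _ , TA≐1) = inv-closed A A∈ in T , T∈ , TA≐1

  rightInverse-∈ : ∀ A A' → ZeroSet P A → A · A' ≐ 1M → ZeroSet P A'
  rightInverse-∈ A A' A∈ AA'≐1 =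
    let (T , T∈ , TA≐1) = leftInverse A A∈ in ZeroSet-≐ T∈ (≐-sym (inverse-unique A A' T TA≐1 AA'≐1))

  commutator-∈ : ∀ t t' x x' → ZeroSet P t → ZeroSet P x → t · t' ≐ 1M → x · x' ≐ 1M →
    ZeroSet P (t · x · t' · x')
  commutator-∈ t t' x x' t∈ x∈ tt' xx' =
    mul-closed _ x' (mul-closed _ t' (mul-closed t x t∈ x∈) (rightInverse-∈ t t' t∈ tt')) (rightInverse-∈ x x' x∈ xx')

-- The group's left inverse spares us the identity adj A · A ≐ det A ⊙ 1M.
rightInverse≐adj : ∀ {n} {P : List (MPoly (suc n))} → IsQGroup P → ∀ A A' →
  ZeroSet P A → det A ≡ 1ℚ → A · A' ≐ 1M → A' ≐ adj A
rightInverse≐adj group A A' A∈ det≡1 AA'≐1 =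
  let (T , _ , TA≐1) = leftInverse group A A∈
  in ≐-trans (inverse-unique A A' T TA≐1 AA'≐1) (≐-sym (inverse-unique A (adj A) T TA≐1 (·-adj-det1 A det≡1)))

commutator-InSLCong : ∀ {n} m a .{{_ : NonZero a}} (t t' x x' : Mat (suc n)) →
  InSLCong (a ^ suc n) t → InNear m a x → t' ≐ adj t → x' ≐ adj x → t · t' ≐ 1M → x · x' ≐ 1M →
  det (t · x · t' · x') ≡ 1ℚ → InSLCong m (t · x · t' · x')
commutator-InSLCong {n} m a t t' x x' (_ , Y , ht) xN@(X , hx) t'≐adj x'≐adj tt' xx' det≡1 =
  det≡1 , (λ i j → proj₁ (W-integral i j)) , λ i j →
    trans (commutator-near-identity k μ (toMat Y) (toMat X) {t} {t'} {x} {x'} ht hx tt' xx' i j)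
          (cong (_+_ (δ i j)) (trans (cong (_* (D · t' · x') i j) kμ≡m·aⁿ)
            (trans (factor i j) (cong (ι (+ m) *_) (proj₂ (W-integral i j))))))
  where
  k μ : ℚ
  k = ι (+ (a ^ suc n))
  μ = + m / a
  D W : Mat (suc n)
  D = toMat Y · toMat X ⊟ toMat X · toMat Y
  W = D · t' · (ι (+ (a ^ n)) ⊙ x')

  D-integral : IntegralM D
  D-integral = IntegralM-⊟ (IntegralM-· (IntegralM-toMat Y) (IntegralM-toMat X))
                           (IntegralM-· (IntegralM-toMat X) (IntegralM-toMat Y))

  t'-integral : IntegralM t'
  t'-integral = IntegralM-≐ (≐-sym t'≐adj)
    (adj-integral t (IntegralM-≐ (≐-sym ht) (IntegralM-1M⊞ι⊙ (+ (a ^ suc n)) Y)))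

  aⁿx'-integral : IntegralM (ι (+ (a ^ n)) ⊙ x')
  aⁿx'-integral = IntegralM-≐ (λ i j → cong (ι (+ (a ^ n)) *_) (sym (x'≐adj i j)))
    (adj-integral-scaled a x (InNear-scaled-integral m a xN))

  W-integral : IntegralM W
  W-integral = IntegralM-· (IntegralM-· D-integral t'-integral) aⁿx'-integral

  kμ≡m·aⁿ : k * μ ≡ ι (+ m) * ι (+ (a ^ n))
  kμ≡m·aⁿ = trans (cong (_* μ) (ι-pow-suc a n))
    (trans (solve 3 (λ p q u → p :* q :* u := p :* u :* q) refl (ι (+ a)) (ι (+ (a ^ n))) μ)
           (cong (_* ι (+ (a ^ n))) (ι-*-/-cancel m a)))

  factor : ∀ i j → ι (+ m) * ι (+ (a ^ n)) * (D · t' · x') i j ≡ ι (+ m) * W i j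
  factor i j = trans (ℚP.*-assoc (ι (+ m)) _ _) (cong (ι (+ m) *_) (sym (⊙-·ʳ (ι (+ (a ^ n))) (D · t') x' i j)))

lemma2p4 : (B : ℕ) (PG PM : List (MPoly B))
             → IsQGroup PG → IsQGroup PM
             → (∀ A → ZeroSet PM A → ZeroSet PG A)
             → (∀ A → ZeroSet PG A → det A ≡ 1ℚ)
             → ∃[ e ] (1 ≤ e × ((m a : ℕ) → .{{_ : NonZero a}} → 1 ≤ m
                 → (t t' x x' : Mat B)
                 → ZeroSet PM t → InSLCong (a ^ e) t
                 → ZeroSet PG x → InNear m a x
                 → t · t' ≐ 1M → x · x' ≐ 1M
                 → ZeroSet PG (t · x · t' · x') × InSLCong m (t · x · t' · x')))
lemma2p4 zero PG PM G M M⊆G detG = 1 , s≤s z≤n ,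
  λ m a _ t t' x x' t∈M _ x∈G _ tt' xx' →
    commutator-∈ G t t' x x' (M⊆G t t∈M) x∈G tt' xx' , refl , (λ ()) , (λ ())
lemma2p4 (suc n) PG PM G M M⊆G detG = suc n , s≤s z≤n ,
  λ m a _ t t' x x' t∈M tS x∈G xN tt' xx' →
    let comm∈G = commutator-∈ G t t' x x' (M⊆G t t∈M) x∈G tt' xx'
    in comm∈G , commutator-InSLCong m a t t' x x' tS xN
                  (rightInverse≐adj M t t' t∈M (proj₁ tS) tt') (rightInverse≐adj G x x' x∈G (detG x x∈G) xx')
                  tt' xx' (detG _ comm∈G)
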